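{- Let $\Sigma$, $F$, $(\mathcal{A},\le)$, $\alpha$, $\gamma$ be as follows: $F$ is a set of functions $f:\wp(\Sigma)^{n_f}\to\wp(\Sigma)$; $(\mathcal{A},\le)$ is a complete lattice satisfying the descending chain condition; $\alpha:\mathrm{Abs}(\wp(\Sigma))\to\mathcal{A}$, $\gamma:\mathcal{A}\to\mathrm{Abs}(\wp(\Sigma))$ are monotone with $\alpha(X)\ge a\iff X\sqsupseteq\gamma(a)$ and $\alpha\circ\gamma=\mathrm{id}$; and either $\alpha\circ F^{\mathcal{M}}=\alpha\circ F^{\mathcal{M}}\circ\gamma\circ\alpha$, or $\mathscr{S}_F\circ\gamma\circ\alpha=\gamma\circ\alpha\circ\mathscr{S}_F\circ\gamma\circ\alpha$. Let $g\in F$ and, for each $a\in\mathcal{A}$, let $\mathrm{subrefiners}^{\mathcal{A}}_g(a)\subseteq\mathrm{refiners}^{\mathcal{A}}_g(a)$ be a subset such that $\mathrm{subrefiners}^{\mathcal{A}}_g(a)=\varnothing\iff\mathrm{refiners}^{\mathcal{A}}_g(a)=\varnothing$. Let $\mathrm{IGPT}^{\mathcal{A}}_F$ be the algorithm $\mathrm{GPT}^{\mathcal{A}}_F$ in which $\mathrm{refiners}^{\mathcal{A}}_g$ is replaced by $\mathrm{subrefiners}^{\mathcal{A}}_g$. Then for every $a\in\mathcal{A}$, $\mathrm{GPT}^{\mathcal{A}}_F(a)=\mathrm{IGPT}^{\mathcal{A}}_F(a)$.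
   Context: An abstract domain of $\wp(\Sigma)$ is identified with a Moore family, i.e. a set $A\subseteq\wp(\Sigma)$ closed under arbitrary intersections (so $\Sigma\in A$); $\mathrm{Abs}(\wp(\Sigma))$ is the set of these. For $X\subseteq\wp(\Sigma)$, $\mathcal{M}(X)=\{\bigcap Y\mid Y\subseteq X\}$ (with $\bigcap\varnothing=\Sigma$). Order: $A_1\sqsubseteq A_2$ iff $A_2\subseteq A_1$; a complete lattice with meet $\mathcal{M}(A_1\cup A_2)$ and join given by intersection. $F(X)=\{f(\vec s)\mid f\in F,\ \vec s\in X^{n_f}\}$, $F^{\mathcal{M}}(X)=\mathcal{M}(F(X))$. $A$ is forward $F$-complete if $F(A)\subseteq A$; $\mathscr{S}_F(A)=\bigsqcup\{X\mid X\sqsubseteq A,\ X\text{ forward }F\text{ -complete}\}$. $\mathrm{refine}_f(\vec S,A)=\mathcal{M}(A\cup\{f(\vec S)\})$; for $a\in\mathcal{A}$, $\mathrm{refine}^{\mathcal{A}}_f(\vec S,a)=\alpha(\mathrm{refine}_f(\vec S,\gamma(a)))$, $\mathrm{refiners}^{\mathcal{A}}_f(a)=\{\vec S\in\gamma(a)^{n_f}\mid \mathrm{refine}^{\mathcal{A}}_f(\vec S,a)<a\}$, $\mathrm{refiners}^{\mathcal{A}}_F(a)=\bigcup_{f\in F}\mathrm{refiners}^{\mathcal{A}}_f(a)$. Algorithm $\mathrm{GPT}^{\mathcal{A}}_F$ on input $a$: while $\mathrm{refiners}^{\mathcal{A}}_F(a)\neq\varnothing$, choose $f\in F$ and $\vec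 S\in\mathrm{refiners}^{\mathcal{A}}_f(a)$ and set $a:=\mathrm{refine}^{\mathcal{A}}_f(\vec S,a)$; output $a$. Under these hypotheses every run of $\mathrm{GPT}^{\mathcal{A}}_F(a)$ terminates with the same output, denoted $\mathrm{GPT}^{\mathcal{A}}_F(a)$; the claim is that every run of $\mathrm{IGPT}^{\mathcal{A}}_F$ on $a$ also terminates with this output. -}

module Defs where

open import Level using (0ℓ)
open import Data.Bool using (Bool; true; false; _∨_)
open import Data.Nat using (ℕ; zero; suc) renaming (_≤_ to _≤ℕ_)
open import Data.Vec using (Vec)
open import Data.Vec.Relation.Unary.All using (All)
open import Data.Vec.Relation.Binary.Pointwise.Inductive using (Pointwise)
open import Data.Product using (Σ; _×_; _,_; proj₁; proj₂; ∃)
open import Relation.Nullary using (¬_; Dec; yes; no)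
open import Relation.Nullary.Decidable using (⌊_⌋)
open import Relation.Binary.PropositionalEquality using (_≡_; _≢_; refl; sym; trans)
open import Axiom.ExcludedMiddle using (ExcludedMiddle)
open import Data.Empty using (⊥-elim)

-- The paper works
-- in classical set theory; we use it to represent subsets and collections of
-- subsets as Bool-valued predicates, so that arbitrary intersections exist.
LEM : Set₁
LEM = ExcludedMiddle 0ℓ

module Order (𝒜 : Set) (_≤_ : 𝒜 → 𝒜 → Set) where

  IsLUB : (𝒜 → Set) → 𝒜 → Set
  IsLUB P s = (∀ x → P x → x ≤ s) × (∀ u → (∀ x → P x → x ≤ u) → s ≤ u)

  IsGLB : (𝒜 → Set) → 𝒜 → Set
  IsGLB P s = (∀ x → P x → s ≤ x) × (∀ l → (∀ x → P x → l ≤ x) → l ≤ s)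

  IsCompleteLattice : Set₁
  IsCompleteLattice = ∀ (P : 𝒜 → Set) → (∃ λ s → IsLUB P s) × (∃ λ i → IsGLB P i)

  DCC : Set
  DCC = ∀ (c : ℕ → 𝒜) → (∀ n → c (suc n) ≤ c n) →
        ∃ λ n → ∀ m → n ≤ℕ m → c m ≡ c n

  _<_ : 𝒜 → 𝒜 → Set
  a < b = (a ≤ b) × (a ≢ b)

module Powerset (lem : LEM) (Car : Set) where

  ‖_‖ : Set → Bool
  ‖ P ‖ = ⌊ lem {P} ⌋

  ‖‖-intro : {P : Set} → P → ‖ P ‖ ≡ true
  ‖‖-intro {P} p with lem {P}
  ... | yes _ = refl
  ... | no ¬p = ⊥-elim (¬p p)

  ‖‖-elim : {P : Set} → ‖ P ‖ ≡ true → P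
  ‖‖-elim {P} e with lem {P}
  ‖‖-elim {P} e | yes p = p
  ‖‖-elim {P} () | no _

  Sub : Set
  Sub = Car → Bool

  _∈ˢ_ : Car → Sub → Set
  x ∈ˢ T = T x ≡ true

  _≗ˢ_ : Sub → Sub → Set
  T ≗ˢ U = ∀ x → T x ≡ U x

  Coll : Set
  Coll = Sub → Bool

  _∈ᶜ_ : Sub → Coll → Set
  T ∈ᶜ X = X T ≡ true

  _⊆ᶜ_ : Coll → Coll → Set
  X ⊆ᶜ Y = ∀ T → T ∈ᶜ X → T ∈ᶜ Y

  -- ⋂ Y  (with ⋂ ∅ = Σ)
  ⋂ : Coll → Sub
  ⋂ Y x = ‖ (∀ T → T ∈ᶜ Y → x ∈ˢ T) ‖

  -- Moore family: a set of subsets (so closed under equality of subsets)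
  -- closed under arbitrary intersections
  record IsMoore (X : Coll) : Set where
    field
      resp  : ∀ T U → T ≗ˢ U → T ∈ᶜ X → U ∈ᶜ X
      meets : ∀ Y → Y ⊆ᶜ X → ⋂ Y ∈ᶜ X

  Abs : Set
  Abs = Σ Coll IsMoore

  col : Abs → Coll
  col = proj₁

  _⊑_ : Abs → Abs → Set
  A₁ ⊑ A₂ = col A₂ ⊆ᶜ col A₁

  _≈ᴬ_ : Abs → Abs → Set
  A₁ ≈ᴬ A₂ = (col A₁ ⊆ᶜ col A₂) × (col A₂ ⊆ᶜ col A₁)

  M : Coll → Coll
  M X T = ‖ Σ Coll (λ Y → (Y ⊆ᶜ X) × (T ≗ˢ ⋂ Y)) ‖

  private
    bool-ext : ∀ {b c : Bool} → (b ≡ true → c ≡ true) → (c ≡ true → b ≡ true) → b ≡ c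
    bool-ext {false} {false} f g = refl
    bool-ext {false} {true} f g = g refl
    bool-ext {true} {false} f g = sym (f refl)
    bool-ext {true} {true} f g = refl

  M-isMoore : ∀ X → IsMoore (M X)
  M-isMoore X = record { resp = rsp ; meets = mts }
    where
    rsp : ∀ T U → T ≗ˢ U → T ∈ᶜ M X → U ∈ᶜ M X
    rsp T U eq m with ‖‖-elim m
    ... | Y , Y⊆X , T≗ = ‖‖-intro (Y , Y⊆X , λ x → trans (sym (eq x)) (T≗ x))

    mts : ∀ Z → Z ⊆ᶜ M X → ⋂ Z ∈ᶜ M X
    mts Z Z⊆ = ‖‖-intro (W , W⊆X , λ x → bool-ext (to x) (from x))
      where
      W : Coll
      W T = ‖ (T ∈ᶜ X) × (∀ y → y ∈ˢ ⋂ Z → y ∈ˢ T) ‖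
      W⊆X : W ⊆ᶜ X
      W⊆X T t = proj₁ (‖‖-elim t)
      to : ∀ x → x ∈ˢ ⋂ Z → x ∈ˢ ⋂ W
      to x xZ = ‖‖-intro (λ T t → proj₂ (‖‖-elim t) x xZ)
      from : ∀ x → x ∈ˢ ⋂ W → x ∈ˢ ⋂ Z
      from x xW = ‖‖-intro λ U u → go U (‖‖-elim (Z⊆ U u)) u
        where
        go : ∀ U → Σ Coll (λ V → (V ⊆ᶜ X) × (U ≗ˢ ⋂ V)) → U ∈ᶜ Z → x ∈ˢ U
        go U (V , V⊆X , U≗) u =
          trans (U≗ x) (‖‖-intro λ T t → ‖‖-elim xW T
            (‖‖-intro (V⊆X T t , λ y yZ →
               ‖‖-elim (trans (sym (U≗ y)) (‖‖-elim yZ U u)) T t)))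

  Mᴬ : Coll → Abs
  Mᴬ X = M X , M-isMoore X

  ⨆ : (Abs → Set) → Abs
  ⨆ P = C , record { resp = rsp ; meets = mts }
    where
    C : Coll
    C T = ‖ (∀ (A : Abs) → P A → T ∈ᶜ col A) ‖
    rsp : ∀ T U → T ≗ˢ U → T ∈ᶜ C → U ∈ᶜ C
    rsp T U eq t = ‖‖-intro λ A pA → IsMoore.resp (proj₂ A) T U eq (‖‖-elim t A pA)
    mts : ∀ Y → Y ⊆ᶜ C → ⋂ Y ∈ᶜ C
    mts Y Y⊆ = ‖‖-intro λ A pA →
      IsMoore.meets (proj₂ A) Y (λ T t → ‖‖-elim (Y⊆ T t) A pA)

  _∪｛_｝ : Coll → Sub → Coll
  (X ∪｛ T ｝) U = X U ∨ ‖ U ≗ˢ T ‖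

  -- A set F of functions f : ℘(Σ)^{n_f} → ℘(Σ), given as a family
  -- indexed by I, with arity ar i and underlying function fun i.

  module Ops (I : Set) (ar : I → ℕ) (fun : (i : I) → Vec Sub (ar i) → Sub) where

    -- each f is a function on sets, i.e. respects equality of subsets
    FunResp : Set
    FunResp = ∀ i (v w : Vec Sub (ar i)) → Pointwise _≗ˢ_ v w → fun i v ≗ˢ fun i w

    Fimg : Coll → Coll
    Fimg X T = ‖ Σ I (λ i → Σ (Vec Sub (ar i)) λ v → All (_∈ᶜ X) v × (T ≗ˢ fun i v)) ‖

    FM : Abs → Abs
    FM X = Mᴬ (Fimg (col X))

    FComplete : Abs → Set
    FComplete A = Fimg (col A) ⊆ᶜ col A

    SF : Abs → Abs
    SF A = ⨆ (λ X → (X ⊑ A) × FComplete X)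

    refine : (i : I) → Vec Sub (ar i) → Abs → Abs
    refine i v A = Mᴬ (col A ∪｛ fun i v ｝)

    module Algo (𝒜 : Set) (_≤_ : 𝒜 → 𝒜 → Set) (α : Abs → 𝒜) (γ : 𝒜 → Abs) where
      open Order 𝒜 _≤_ using (_<_)

      refineᴬ : (i : I) → Vec Sub (ar i) → 𝒜 → 𝒜
      refineᴬ i v a = α (refine i v (γ a))

      Refiner : (i : I) → 𝒜 → Vec Sub (ar i) → Set
      Refiner i a v = All (_∈ᶜ col (γ a)) v × (refineᴬ i v a < a)

      data GStep (a : 𝒜) : 𝒜 → Set where
        gstep : ∀ i v → Refiner i a v → GStep a (refineᴬ i v a)

      GHalt : 𝒜 → Set
      GHalt a = ∀ i v → ¬ Refiner i a v

      module Incremental (g : I) (sub : 𝒜 → Vec Sub (ar g) → Set) where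

        data IStep (a : 𝒜) : 𝒜 → Set where
          other      : ∀ i → i ≢ g → ∀ v → Refiner i a v → IStep a (refineᴬ i v a)
          restricted : ∀ v → sub a v → IStep a (refineᴬ g v a)

        IHalt : 𝒜 → Set
        IHalt a = (∀ i → i ≢ g → ∀ v → ¬ Refiner i a v) × (∀ v → ¬ sub a v)

        InfiniteIRun : 𝒜 → Set
        InfiniteIRun a = Σ (ℕ → 𝒜) λ c → (c zero ≡ a) × (∀ n → IStep (c n) (c (suc n)))

{-# OPTIONS --safe #-}

-- A GPT step from b adds to γ(b) one set f(S⃗) with S⃗ drawn from γ(b).  Hence,
-- if γ(x) is forward F-complete, the bound x ≤ b is preserved by every step.
-- A halting state c has γ(c) forward F-complete, since an f(S⃗) missing from
-- γ(c) would make S⃗ a refiner; so any two halting states reachable from a lie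
-- below each other and coincide.  Every IGPT step is a GPT step and IGPT halts
-- exactly when GPT does, so IGPT can only stop at the GPT output; steps strictly
-- descend, so by DCC no run is infinite, and choosing refiners classically
-- yields a halting GPT run.

module Submission where

open import Defs
open import Data.Nat using (ℕ)
open import Data.Vec using (Vec)
open import Data.Product using (Σ; _×_)
open import Data.Sum using (_⊎_)
open import Function.Bundles using (_⇔_)
open import Relation.Nullary using (¬_)
open import Relation.Binary.PropositionalEquality using (_≡_)
open import Relation.Binary.Structures using (IsPartialOrder)
open import Relation.Binary.Construct.Closure.ReflexiveTransitive using (Star)

open import Data.Bool using (true; false; _∨_)
open import Data.Bool.Properties using (⇔→≡; ∨-zeroʳ) renaming (_≟_ to _≟ᵇ_)
open import Data.Empty using (⊥-elim)
open import Data.Nat using (zero; suc)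
open import Data.Nat.Properties using (n≤1+n)
open import Data.Product using (_,_; proj₁; proj₂)
open import Data.Vec.Relation.Unary.All as All using (All)
open import Function using (_∘_; flip)
open import Function.Bundles using (Equivalence; mk⇔)
open import Relation.Binary.PropositionalEquality using (refl; sym; trans; cong)
open import Relation.Binary.Construct.Closure.ReflexiveTransitive
  using (ε; _◅_; _◅◅_; fold; map)
open import Relation.Nullary using (yes; no)
open import Relation.Nullary.Decidable using (decidable-stable)

module DescendingRelation
  {𝒜 : Set} {_≤_ : 𝒜 → 𝒜 → Set} (po : IsPartialOrder _≡_ _≤_)
  {_⟶_ : 𝒜 → 𝒜 → Set} (⟶-< : ∀ {b b′} → b ⟶ b′ → Order._<_ 𝒜 _≤_ b′ b)
  where

  open Order 𝒜 _≤_
  private module PO = IsPartialOrder po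

  Irreducible : 𝒜 → Set
  Irreducible b = ∀ b′ → ¬ b ⟶ b′

  ⟶*-≤ : ∀ {a b} → Star _⟶_ a b → b ≤ a
  ⟶*-≤ = fold (flip _≤_) (λ s b≤a → PO.trans b≤a (proj₁ (⟶-< s))) PO.refl

  DCC⇒no-infinite-chain : DCC → (c : ℕ → 𝒜) → ¬ (∀ n → c n ⟶ c (suc n))
  DCC⇒no-infinite-chain dcc c steps with dcc c (proj₁ ∘ ⟶-< ∘ steps)
  ... | n , stable = proj₂ (⟶-< (steps n)) (stable (suc n) (n≤1+n n))

  data Move (b : 𝒜) : 𝒜 → Set where
    step : ∀ {b′} → b ⟶ b′ → Move b b′
    stay : Irreducible b → Move b b

  move : LEM → ∀ b → Σ 𝒜 (Move b)
  move lem b with lem {Σ 𝒜 (b ⟶_)}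
  ... | yes (b′ , s) = b′ , step s
  ... | no irreducible = b , stay (λ b′ s → irreducible (b′ , s))

  module _ (lem : LEM) (dcc : DCC) (a : 𝒜) where

    private
      chain : ℕ → 𝒜
      chain zero    = a
      chain (suc n) = proj₁ (move lem (chain n))

      chain-desc : ∀ n → chain (suc n) ≤ chain n
      chain-desc n with move lem (chain n)
      ... | _ , step s = proj₁ (⟶-< s)
      ... | _ , stay _ = PO.refl

      a⟶*chain : ∀ n → Star _⟶_ a (chain n)
      a⟶*chain zero = ε
      a⟶*chain (suc n) with move lem (chain n)
      ... | _ , step s = a⟶*chain n ◅◅ (s ◅ ε)
      ... | _ , stay _ = a⟶*chain n

    DCC⇒normal-form : Σ 𝒜 λ c → Star _⟶_ a c × Irreducible c
    DCC⇒normal-form with dcc chain chain-desc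
    ... | n , stable with move lem (chain n) | stable (suc n) (n≤1+n n)
    ...   | _ , step s   | fixed = ⊥-elim (proj₂ (⟶-< s) fixed)
    ...   | _ , stay irr | _     = chain n , a⟶*chain n , irr

module MooreFamilies (lem : LEM) (Car : Set) where

  open Powerset lem Car

  ∈-M : ∀ {X T} → (∀ U → U ≗ˢ T → U ∈ᶜ X) → T ∈ᶜ M X
  ∈-M {X} {T} ≗T⇒∈X = ‖‖-intro (Y , (λ U U∈Y → ≗T⇒∈X U (‖‖-elim U∈Y)) , T≗⋂Y)
    where
    Y : Coll
    Y U = ‖ U ≗ˢ T ‖

    T≗⋂Y : T ≗ˢ ⋂ Y
    T≗⋂Y x = ⇔→≡ (mk⇔ (λ x∈T → ‖‖-intro λ U U∈Y → trans (‖‖-elim U∈Y x) x∈T)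
                      (λ x∈⋂Y → ‖‖-elim x∈⋂Y T (‖‖-intro λ _ → refl)))

  M-least : ∀ {X} (A : Abs) → X ⊆ᶜ col A → M X ⊆ᶜ col A
  M-least (A , moore) X⊆A T T∈MX with ‖‖-elim T∈MX
  ... | Y , Y⊆X , T≗⋂Y =
    IsMoore.resp moore (⋂ Y) T (sym ∘ T≗⋂Y)
      (IsMoore.meets moore Y (λ U → X⊆A U ∘ Y⊆X U))

  ⊆-M-∪｛｝ : ∀ (A : Abs) T → col A ⊆ᶜ M (col A ∪｛ T ｝)
  ⊆-M-∪｛｝ (A , moore) T U U∈A = ∈-M λ V V≗U →
    cong (_∨ _) (IsMoore.resp moore U V (sym ∘ V≗U) U∈A)

  ∈-M-∪｛｝ : ∀ X T → T ∈ᶜ M (X ∪｛ T ｝)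
  ∈-M-∪｛｝ X T = ∈-M λ U U≗T →
    trans (cong (X U ∨_) (‖‖-intro U≗T)) (∨-zeroʳ (X U))

  ∪｛｝-least : ∀ {X T} (A : Abs) → X ⊆ᶜ col A → T ∈ᶜ col A → (X ∪｛ T ｝) ⊆ᶜ col A
  ∪｛｝-least {X} {T} (A , moore) X⊆A T∈A U U∈X∪T with X U in U∈X
  ... | true  = X⊆A U U∈X
  ... | false = IsMoore.resp moore T U (sym ∘ ‖‖-elim U∈X∪T) T∈A

module Refinement (lem : LEM) (Car : Set) where

  open Powerset lem Car
  open MooreFamilies lem Car

  module _ (I : Set) (ar : I → ℕ) (fun : (i : I) → Vec Sub (ar i) → Sub) where

    open Ops I ar fun

    refine-least : ∀ (A B : Abs) i v →
                   col B ⊆ᶜ col A → fun i v ∈ᶜ col A → col (refine i v B) ⊆ᶜ col A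
    refine-least A B i v B⊆A f∈A = M-least A (∪｛｝-least A B⊆A f∈A)

    ∈-Fimg : ∀ {X} i {v} → All (_∈ᶜ X) v → fun i v ∈ᶜ Fimg X
    ∈-Fimg i {v} v∈X = ‖‖-intro (i , v , v∈X , λ _ → refl)

    module GaloisRefinement
      (𝒜 : Set) (_≤_ : 𝒜 → 𝒜 → Set) (po : IsPartialOrder _≡_ _≤_)
      (α : Abs → 𝒜) (γ : 𝒜 → Abs)
      (α-mono : ∀ X Y → X ⊑ Y → α X ≤ α Y)
      (γ-mono : ∀ a b → a ≤ b → γ a ⊑ γ b)
      (galois : ∀ X a → (a ≤ α X) ⇔ (γ a ⊑ X))
      (αγ≡id : ∀ a → α (γ a) ≡ a)
      where

      open Order 𝒜 _≤_
      open Algo 𝒜 _≤_ α γ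
      private module PO = IsPartialOrder po

      refineᴬ-≤ : ∀ i v b → refineᴬ i v b ≤ b
      refineᴬ-≤ i v b =
        PO.trans (α-mono _ _ (⊆-M-∪｛｝ (γ b) (fun i v))) (PO.reflexive (αγ≡id b))

      refineᴬ-fixed⇒∈ : ∀ i v b → refineᴬ i v b ≡ b → fun i v ∈ᶜ col (γ b)
      refineᴬ-fixed⇒∈ i v b fixed =
        Equivalence.to (galois _ b) (PO.reflexive (sym fixed)) (fun i v)
          (∈-M-∪｛｝ (col (γ b)) (fun i v))

      GStep-< : ∀ {b b′} → GStep b b′ → b′ < b
      GStep-< (gstep i v (_ , refined)) = refined

      GHalt⇒FComplete : ∀ c → GHalt c → FComplete (γ c)
      GHalt⇒FComplete c halt T T∈F with ‖‖-elim T∈F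
      ... | i , v , v∈γc , T≗fv = IsMoore.resp (proj₂ (γ c)) (fun i v) T (sym ∘ T≗fv) fv∈γc
        where
        fv∈γc : fun i v ∈ᶜ col (γ c)
        fv∈γc = decidable-stable (col (γ c) (fun i v) ≟ᵇ true) λ fv∉γc →
          halt i v (v∈γc , refineᴬ-≤ i v c , fv∉γc ∘ refineᴬ-fixed⇒∈ i v c)

      ≤-refineᴬ : ∀ {x b} i {v} → FComplete (γ x) → x ≤ b →
                  All (_∈ᶜ col (γ b)) v → x ≤ refineᴬ i v b
      ≤-refineᴬ {x} {b} i {v} complete x≤b v∈γb =
        Equivalence.from (galois _ x)
          (refine-least (γ x) (γ b) i v γb⊆γx
            (complete (fun i v) (∈-Fimg {col (γ x)} i (All.map (λ {T} → γb⊆γx T) v∈γb))))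
        where
        γb⊆γx : γ x ⊑ γ b
        γb⊆γx = γ-mono x b x≤b

      ≤-GStep* : ∀ {x a b} → FComplete (γ x) → x ≤ a → Star GStep a b → x ≤ b
      ≤-GStep* complete x≤a ε = x≤a
      ≤-GStep* complete x≤a (gstep i v (v∈γa , _) ◅ steps) =
        ≤-GStep* complete (≤-refineᴬ i complete x≤a v∈γa) steps

      open DescendingRelation po GStep-< public

      GHalt-unique : ∀ {a b c} → Star GStep a b → GHalt b →
                     Star GStep a c → GHalt c → b ≡ c
      GHalt-unique {b = b} {c} a⟶*b b-halts a⟶*c c-halts = PO.antisym
        (≤-GStep* (GHalt⇒FComplete b b-halts) (⟶*-≤ a⟶*b) a⟶*c)
        (≤-GStep* (GHalt⇒FComplete c c-halts) (⟶*-≤ a⟶*c) a⟶*b)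

      Irreducible⇒GHalt : ∀ {c} → Irreducible c → GHalt c
      Irreducible⇒GHalt irr i v r = irr _ (gstep i v r)

      GPT-halts : DCC → ∀ a → Σ 𝒜 λ c → Star GStep a c × GHalt c
      GPT-halts dcc a with c , a⟶*c , c-irreducible ← DCC⇒normal-form lem dcc a =
        c , a⟶*c , Irreducible⇒GHalt c-irreducible

      module Restricted (g : I) (sub : 𝒜 → Vec Sub (ar g) → Set)
        (sub⊆Refiner : ∀ a v → sub a v → Refiner g a v)
        (sub-empty⇔ : ∀ a → (∀ v → ¬ sub a v) ⇔ (∀ v → ¬ Refiner g a v))
        where

        open Incremental g sub

        IStep⇒GStep : ∀ {b b′} → IStep b b′ → GStep b b′
        IStep⇒GStep (other i _ v r)  = gstep i v r
        IStep⇒GStep (restricted v s) = gstep g v (sub⊆Refiner _ v s)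

        IHalt⇒GHalt : ∀ {b} → IHalt b → GHalt b
        IHalt⇒GHalt {b} (others-halt , sub-empty) i v r with lem {i ≡ g}
        ... | yes refl = Equivalence.to (sub-empty⇔ b) sub-empty v r
        ... | no i≢g   = others-halt i i≢g v r

corollary4p5 : (lem : LEM) (Car : Set) →
    let open Powerset lem Car in
    (I : Set) (ar : I → ℕ) (fun : (i : I) → Vec Sub (ar i) → Sub) →
    let open Ops I ar fun in
    FunResp →
    (𝒜 : Set) (_≤_ : 𝒜 → 𝒜 → Set) →
    let open Order 𝒜 _≤_ in
    IsPartialOrder _≡_ _≤_ → IsCompleteLattice → DCC →
    (α : Abs → 𝒜) (γ : 𝒜 → Abs) →
    let open Algo 𝒜 _≤_ α γ in
    (∀ X Y → X ⊑ Y → α X ≤ α Y) →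
    (∀ a b → a ≤ b → γ a ⊑ γ b) →
    (∀ X a → (a ≤ α X) ⇔ (γ a ⊑ X)) →
    (∀ a → α (γ a) ≡ a) →
    ((∀ X → α (FM X) ≡ α (FM (γ (α X))))
    ⊎ (∀ X → SF (γ (α X)) ≈ᴬ γ (α (SF (γ (α X)))))) →
    (g : I) (sub : 𝒜 → Vec Sub (ar g) → Set) →
    (∀ a v → sub a v → Refiner g a v) →
    (∀ a → (∀ v → ¬ sub a v) ⇔ (∀ v → ¬ Refiner g a v)) →
    let open Incremental g sub in
    (a : 𝒜) →
    Σ 𝒜 (λ c → (Star GStep a c × GHalt c)
    × (∀ b → Star IStep a b → IHalt b → b ≡ c)
    × ¬ InfiniteIRun a)
corollary4p5 lem Car I ar fun _ 𝒜 _≤_ po _ dcc α γ α-mono γ-mono galois αγ≡id _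
             g sub sub⊆Refiner sub-empty⇔ a =
  let open Refinement lem Car
      open GaloisRefinement I ar fun 𝒜 _≤_ po α γ α-mono γ-mono galois αγ≡id
      open Restricted g sub sub⊆Refiner sub-empty⇔
      (c , a⟶*c , c-halts) = GPT-halts dcc a
  in c , (a⟶*c , c-halts)
   , (λ b a⟶*b b-halts →
        GHalt-unique (map IStep⇒GStep a⟶*b) (IHalt⇒GHalt b-halts) a⟶*c c-halts)
   , λ (run , _ , steps) → DCC⇒no-infinite-chain dcc run (IStep⇒GStep ∘ steps)
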